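{- Let $0<\varepsilon<1/2$. There exists an integer $n_0$ such that for all $n\ge n_0$ the following holds. Suppose $K_n^c$ is an edge-coloured $K_n$ with $\Delta_{\mathrm{mon}}(K_n^c)\le(1/2-\varepsilon)n$. Then there exists a family $\mathcal{F}'$ of vertex-disjoint properly coloured paths on $4$ vertices such that $|\mathcal{F}'|\le 2^{ -7}\varepsilon^2 n$ and, for all distinct vertices $x_1,x_2,y_1,y_2\in V(K_n^c)$, $|\mathcal{L}(x_1,x_2;y_1,y_2)\cap\mathcal{F}'|\ge 1$.
   Context: $\Delta_{\mathrm{mon}}(K_n^c)$ is the maximum, over vertices $v$ and colours $a$, of the number of edges of colour $a$ at $v$. A path is properly coloured if no two consecutive edges have the same colour; paths are directed sequences of distinct vertices. For distinct vertices $x_1,x_2,y_1,y_2$, a path $P$ is an absorbing path for $(x_1,x_2;y_1,y_2)$ if (i) $P=z_1z_2z_3z_4$ is a properly coloured path on $4$ vertices; (ii) $V(P)\cap\{x_1,x_2,y_1,y_2\}=\emptyset$; (iii) both $z_1z_2x_1x_2$ and $y_1y_2z_3z_4$ are properly coloured paths. $\mathcal{L}(x_1,x_2;y_1,y_2)$ is the set of absorbing paths for $(x_1,x_2;y_1,y_2)$.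
   Formalization: The parameter ε ranges over the rationals strictly between 0 and 1/2. -}

module Defs where

open import Data.Nat using (ℕ)
open import Data.Fin using (Fin)
open import Data.List using (List; []; _∷_; length; filter; concatMap)
open import Data.List.Relation.Unary.Unique.Propositional using (Unique)
open import Data.Fin.Properties using () renaming (_≟_ to _≟ᶠ_)
open import Data.Product using (_×_; _,_; Σ)
open import Relation.Binary.PropositionalEquality using (_≡_; _≢_)
open import Relation.Nullary using (¬_)
open import Relation.Nullary.Decidable using (_×-dec_; ¬?)
import Data.Nat as ℕ
open import Data.Integer using (+_)
open import Data.Rational using (ℚ; _/_)
open import Data.Unit using (⊤)
open import Data.List using (allFin)
open import Data.List.Membership.Propositional using (_∈_)

-- An edge-colouring of K_n: vertices Fin n, colours ℕ, colour of edge uv is c u v.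
-- Symmetry is required for distinct u,v (loops are irrelevant).
Colouring : ℕ → Set
Colouring n = Fin n → Fin n → ℕ

Symmetric : ∀ {n} → Colouring n → Set
Symmetric {n} c = ∀ (u v : Fin n) → u ≢ v → c u v ≡ c v u

monDeg : ∀ {n} → Colouring n → Fin n → ℕ → ℕ
monDeg {n} c v a =
  length (filter (λ u → ¬? (u ≟ᶠ v) ×-dec (c v u ℕ.≟ a)) (allFin n))

toℚ : ℕ → ℚ
toℚ m = (+ m) / 1

ConsecDistinct : ∀ {n} → Colouring n → List (Fin n) → Set
ConsecDistinct c [] = ⊤
ConsecDistinct c (x ∷ []) = ⊤
ConsecDistinct c (x ∷ y ∷ []) = ⊤
ConsecDistinct c (x ∷ y ∷ z ∷ rest) = (c x y ≢ c y z) × ConsecDistinct c (y ∷ z ∷ rest)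

PCPath : ∀ {n} → Colouring n → List (Fin n) → Set
PCPath c xs = Unique xs × ConsecDistinct c xs

Path4 : ℕ → Set
Path4 n = Fin n × Fin n × Fin n × Fin n

vertices : ∀ {n} → Path4 n → List (Fin n)
vertices (z₁ , z₂ , z₃ , z₄) = z₁ ∷ z₂ ∷ z₃ ∷ z₄ ∷ []

Absorbing : ∀ {n} → Colouring n → Fin n → Fin n → Fin n → Fin n → Path4 n → Set
Absorbing c x₁ x₂ y₁ y₂ P@(z₁ , z₂ , z₃ , z₄) =
  PCPath c (vertices P)
  × Unique (z₁ ∷ z₂ ∷ z₃ ∷ z₄ ∷ x₁ ∷ x₂ ∷ y₁ ∷ y₂ ∷ [])  -- with P a path and x's,y's distinct, this is V(P) ∩ {x1,x2,y1,y2} = ∅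
  × PCPath c (z₁ ∷ z₂ ∷ x₁ ∷ x₂ ∷ [])
  × PCPath c (y₁ ∷ y₂ ∷ z₃ ∷ z₄ ∷ [])

VertexDisjointPCFamily : ∀ {n} → Colouring n → List (Path4 n) → Set
VertexDisjointPCFamily c F =
  (∀ P → P ∈ F → PCPath c (vertices P))
  × Unique (concatMap vertices F)

-- Instead of the paper's random selection we use a deterministic greedy argument.
-- Let r be the denominator of ε, so ε ≥ 1/r and every monochromatic degree is at most
-- (1/2 - 1/r)n.  Then from any vertex at least n/r edges avoid two given colours and a small
-- forbidden set, so choosing z₂, z₃, z₁, z₄ in turn shows that each tuple has at least (n/r)^4
-- absorbing paths avoiding the vertices already used.  By double counting and averaging some
-- such path absorbs a 1/r^4 fraction of the still uncovered tuples; r^4 greedy steps therefore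
-- halve their number, and r^4·4·log₂ n steps cover all n^4 tuples.  For n large this is at
-- most ε²n/128 paths.
module Submission where

module Counting where
  open import Data.Nat
  open import Data.Nat.Properties
  open import Data.Nat.ListAction using (sum)
  open import Data.Nat.Tactic.RingSolver using (solve-∀)
  open import Data.List using (List; []; _∷_; length; filter; map; concatMap)
  open import Data.List.Properties using (length-++; filter-++; filter-all; filter-none; filter-some; map-cong)
  open import Data.List.Membership.Propositional using (_∈_)
  open import Data.List.Relation.Unary.Any as Any using (here; there)
  import Data.List.Relation.Unary.All as All
  open import Data.List.Relation.Unary.AllPairs using (_∷_)
  open import Data.List.Relation.Unary.Unique.Propositional using (Unique)
  open import Data.Sum using (_⊎_; inj₁; inj₂)
  open import Data.Product using (_×_; _,_; Σ)
  open import Data.Empty using (⊥-elim)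
  open import Data.Unit using (⊤; tt)
  open import Function using (_∘_)
  open import Level using (0ℓ)
  open import Relation.Binary using (DecidableEquality)
  open import Relation.Binary.PropositionalEquality
  open import Relation.Nullary using (¬_; Dec; yes; no)
  open import Relation.Nullary.Decidable using (_×-dec_; ¬?)
  open import Relation.Unary using (Pred; Decidable)

  count : {A : Set} {P : Pred A 0ℓ} → Decidable P → List A → ℕ
  count P? xs = length (filter P? xs)

  indicator : {P : Set} → Dec P → ℕ
  indicator (yes _) = 1
  indicator (no _) = 0

  module _ {A : Set} where

    count-mono : {P Q : Pred A 0ℓ} (P? : Decidable P) (Q? : Decidable Q) →
      (∀ x → P x → Q x) → (xs : List A) → count P? xs ≤ count Q? xs
    count-mono P? Q? P⊆Q [] = z≤n
    count-mono P? Q? P⊆Q (x ∷ xs) with P? x | Q? x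
    ... | yes _  | yes _  = s≤s (count-mono P? Q? P⊆Q xs)
    ... | yes px | no ¬qx = ⊥-elim (¬qx (P⊆Q x px))
    ... | no _   | yes _  = m≤n⇒m≤1+n (count-mono P? Q? P⊆Q xs)
    ... | no _   | no _   = count-mono P? Q? P⊆Q xs

    count-split : {P Q : Pred A 0ℓ} (P? : Decidable P) (Q? : Decidable Q) (xs : List A) →
      count P? xs ≡ count (λ x → P? x ×-dec Q? x) xs + count (λ x → P? x ×-dec ¬? (Q? x)) xs
    count-split P? Q? [] = refl
    count-split P? Q? (x ∷ xs) with P? x | Q? x
    ... | yes _ | yes _ = cong suc (count-split P? Q? xs)
    ... | yes _ | no _  = trans (cong suc (count-split P? Q? xs)) (sym (+-suc _ _))
    ... | no _  | yes _ = count-split P? Q? xs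
    ... | no _  | no _  = count-split P? Q? xs

    count-union : {P Q R : Pred A 0ℓ} (P? : Decidable P) (Q? : Decidable Q) (R? : Decidable R) →
      (∀ x → P x → Q x ⊎ R x) → (xs : List A) → count P? xs ≤ count Q? xs + count R? xs
    count-union P? Q? R? cover xs = begin
      count P? xs                                                         ≡⟨ count-split P? Q? xs ⟩
      count (λ x → P? x ×-dec Q? x) xs + count (λ x → P? x ×-dec ¬? (Q? x)) xs
        ≤⟨ +-mono-≤ (count-mono _ Q? (λ _ (_ , q) → q) xs) (count-mono _ R? inR xs) ⟩
      count Q? xs + count R? xs                                           ∎
      where
      open ≤-Reasoning
      inR : ∀ x → _ → _
      inR x (p , ¬q) with cover x p
      ... | inj₁ q = ⊥-elim (¬q q)
      ... | inj₂ r = r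

    length-≤-union : {Q R : Pred A 0ℓ} (Q? : Decidable Q) (R? : Decidable R) →
      (∀ x → Q x ⊎ R x) → (xs : List A) → length xs ≤ count Q? xs + count R? xs
    length-≤-union Q? R? cover xs =
      subst (_≤ count Q? xs + count R? xs) (cong length (filter-all always {xs} (All.universal _ xs)))
        (count-union always Q? R? (λ x _ → cover x) xs)
      where
      always : Decidable (λ (_ : A) → ⊤)
      always _ = yes tt

    count-zero : {P : Pred A 0ℓ} (P? : Decidable P) (xs : List A) →
      count P? xs ≡ 0 → ∀ {x} → x ∈ xs → ¬ P x
    count-zero P? xs count≡0 x∈xs px =
      <⇒≢ (filter-some P? (Any.map (λ { refl → px }) x∈xs)) (sym count≡0)

    count-filter : {P Q : Pred A 0ℓ} (P? : Decidable P) (Q? : Decidable Q) (xs : List A) →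
      count P? (filter Q? xs) ≡ count (λ x → Q? x ×-dec P? x) xs
    count-filter P? Q? [] = refl
    count-filter P? Q? (x ∷ xs) with Q? x
    ... | no _ = count-filter P? Q? xs
    ... | yes _ with P? x
    ...   | yes _ = cong suc (count-filter P? Q? xs)
    ...   | no _  = count-filter P? Q? xs

    count-as-sum : {P : Pred A 0ℓ} (P? : Decidable P) (xs : List A) →
      count P? xs ≡ sum (map (indicator ∘ P?) xs)
    count-as-sum P? [] = refl
    count-as-sum P? (x ∷ xs) with P? x
    ... | yes _ = cong suc (count-as-sum P? xs)
    ... | no _  = count-as-sum P? xs

    sum-≥-count : {G : Pred A 0ℓ} (G? : Decidable G) (g : A → ℕ) (k : ℕ) →
      (∀ x → G x → k ≤ g x) → (xs : List A) → count G? xs * k ≤ sum (map g xs)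
    sum-≥-count G? g k bound [] = z≤n
    sum-≥-count G? g k bound (x ∷ xs) with G? x
    ... | yes gx = +-mono-≤ (bound x gx) (sum-≥-count G? g k bound xs)
    ... | no _   = ≤-trans (sum-≥-count G? g k bound xs) (m≤n+m _ _)

    sum-scale : (k : ℕ) (g : A → ℕ) (xs : List A) → sum (map (λ x → k * g x) xs) ≡ k * sum (map g xs)
    sum-scale k g [] = sym (*-zeroʳ k)
    sum-scale k g (x ∷ xs) = trans (cong (k * g x +_) (sum-scale k g xs)) (sym (*-distribˡ-+ k (g x) _))

    sum-+ : (f g : A → ℕ) (xs : List A) →
      sum (map (λ x → f x + g x) xs) ≡ sum (map f xs) + sum (map g xs)
    sum-+ f g [] = refl
    sum-+ f g (x ∷ xs) = trans (cong (f x + g x +_) (sum-+ f g xs)) (interchange (f x) (g x) _ _)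
      where
      interchange : ∀ a b c d → a + b + (c + d) ≡ a + c + (b + d)
      interchange = solve-∀

    sum-zero : (xs : List A) → sum (map (λ _ → 0) xs) ≡ 0
    sum-zero [] = refl
    sum-zero (_ ∷ xs) = sum-zero xs

    averaging : (g : A → ℕ) (xs : List A) →
      (Σ A λ x → x ∈ xs × sum (map g xs) ≤ length xs * g x) ⊎ sum (map g xs) ≡ 0
    averaging g [] = inj₂ refl
    averaging g (y ∷ ys) with averaging g ys
    ... | inj₂ rest≡0 = inj₁ (y , here refl , ≤-trans (≤-reflexive (trans (cong (g y +_) rest≡0) (+-identityʳ _))) (m≤m+n _ _))
    ... | inj₁ (z , z∈ys , avg) with g z ≤? g y
    ...   | yes gz≤gy = inj₁ (y , here refl , +-monoʳ-≤ (g y) (≤-trans avg (*-monoʳ-≤ (length ys) gz≤gy)))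
    ...   | no gz≰gy  = inj₁ (z , there z∈ys , +-mono-≤ (<⇒≤ (≰⇒> gz≰gy)) avg)

  module _ {A B : Set} where

    count-concatMap : {P : Pred B 0ℓ} (P? : Decidable P) (f : A → List B) (xs : List A) →
      count P? (concatMap f xs) ≡ sum (map (λ x → count P? (f x)) xs)
    count-concatMap P? f [] = refl
    count-concatMap P? f (x ∷ xs) =
      trans (trans (cong length (filter-++ P? (f x) (concatMap f xs))) (length-++ (filter P? (f x))))
            (cong (count P? (f x) +_) (count-concatMap P? f xs))

    length-concatMap : (f : A → List B) (k : ℕ) → (∀ x → length (f x) ≡ k) →
      (xs : List A) → length (concatMap f xs) ≡ length xs * k
    length-concatMap f k len [] = refl
    length-concatMap f k len (x ∷ xs) = trans (length-++ (f x)) (cong₂ _+_ (len x) (length-concatMap f k len xs))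

    sum-swap : (f : A → B → ℕ) (xs : List A) (ys : List B) →
      sum (map (λ x → sum (map (f x) ys)) xs) ≡ sum (map (λ y → sum (map (λ x → f x y) xs)) ys)
    sum-swap f [] ys = sym (sum-zero ys)
    sum-swap f (x ∷ xs) ys =
      trans (cong (sum (map (f x) ys) +_) (sum-swap f xs ys)) (sym (sum-+ (f x) _ ys))

    count-swap : {R : A → B → Set} (R? : ∀ x y → Dec (R x y)) (xs : List A) (ys : List B) →
      sum (map (λ x → count (R? x) ys) xs) ≡ sum (map (λ y → count (λ x → R? x y) xs) ys)
    count-swap R? xs ys = begin
      sum (map (λ x → count (R? x) ys) xs)
        ≡⟨ cong sum (map-cong (λ x → count-as-sum (R? x) ys) xs) ⟩
      sum (map (λ x → sum (map (λ y → indicator (R? x y)) ys)) xs)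
        ≡⟨ sum-swap (λ x y → indicator (R? x y)) xs ys ⟩
      sum (map (λ y → sum (map (λ x → indicator (R? x y)) xs)) ys)
        ≡⟨ cong sum (map-cong (λ y → sym (count-as-sum (λ x → R? x y) xs)) ys) ⟩
      sum (map (λ y → count (λ x → R? x y) xs) ys) ∎
      where open ≡-Reasoning

  module _ {A : Set} (_≟_ : DecidableEquality A) where

    count-members : (S xs : List A) → Unique xs → count (λ z → Any.any? (z ≟_) S) xs ≤ length S
    count-members [] xs _ = ≤-reflexive (cong length (filter-none _ (All.universal (λ _ ()) xs)))
    count-members (s ∷ S) xs unique =
      ≤-trans (count-union (λ z → Any.any? (z ≟_) (s ∷ S)) (_≟ s) (λ z → Any.any? (z ≟_) S)
                 (λ { _ (here eq) → inj₁ eq ; _ (there m) → inj₂ m }) xs)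
              (+-mono-≤ (at-most-once xs unique) (count-members S xs unique))
      where
      at-most-once : (xs : List A) → Unique xs → count (_≟ s) xs ≤ 1
      at-most-once [] _ = z≤n
      at-most-once (x ∷ xs) (x∉xs ∷ unique) with x ≟ s
      ... | yes refl = s≤s (≤-reflexive (cong length (filter-none (_≟ s) (All.map (λ x≢y y≡x → x≢y (sym y≡x)) x∉xs))))
      ... | no _     = at-most-once xs unique

module Arithmetic where
  open import Data.Nat
  open import Data.Nat.Properties
  open import Data.Nat.Tactic.RingSolver using (solve-∀)
  open import Relation.Binary.PropositionalEquality

  -- The arithmetic behind the existence of fresh continuations: if n ≤ X + s + d₁ + d₂,
  -- where r·s ≤ n and each dᵢ ≤ (1/2 - 1/r) n, then at least n/r of the n vertices lie in X.
  fresh-arithmetic : ∀ n r X s d₁ d₂ → n ≤ X + s + d₁ + d₂ → r * s ≤ n →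
    2 * r * d₁ + 2 * n ≤ r * n → 2 * r * d₂ + 2 * n ≤ r * n → n ≤ r * X
  fresh-arithmetic n r X s d₁ d₂ cover small-s low₁ low₂ =
    *-cancelˡ-≤ 2 (+-cancelʳ-≤ (Y + 2 * n) (2 * n) (2 * (r * X)) key)
    where
    open ≤-Reasoning
    Y = 2 * r * d₁ + 2 * r * d₂
    key : 2 * n + (Y + 2 * n) ≤ 2 * (r * X) + (Y + 2 * n)
    key = begin
      2 * n + (Y + 2 * n)                   ≡⟨ regroup₁ n r d₁ d₂ ⟩
      (2 * r * d₁ + 2 * n) + (2 * r * d₂ + 2 * n) ≤⟨ +-mono-≤ low₁ low₂ ⟩
      r * n + r * n                         ≡⟨ regroup₂ r n ⟩
      2 * (r * n)                           ≤⟨ *-monoʳ-≤ 2 (*-monoʳ-≤ r cover) ⟩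
      2 * (r * (X + s + d₁ + d₂))           ≡⟨ regroup₃ r X s d₁ d₂ ⟩
      2 * (r * X) + 2 * (r * s) + Y         ≤⟨ +-monoˡ-≤ Y (+-monoʳ-≤ (2 * (r * X)) (*-monoʳ-≤ 2 small-s)) ⟩
      2 * (r * X) + 2 * n + Y               ≡⟨ +-assoc (2 * (r * X)) (2 * n) Y ⟩
      2 * (r * X) + (2 * n + Y)             ≡⟨ cong (2 * (r * X) +_) (+-comm (2 * n) Y) ⟩
      2 * (r * X) + (Y + 2 * n)             ∎
      where
      regroup₁ : ∀ n r d₁ d₂ → 2 * n + (2 * r * d₁ + 2 * r * d₂ + 2 * n) ≡ (2 * r * d₁ + 2 * n) + (2 * r * d₂ + 2 * n)
      regroup₁ = solve-∀
      regroup₂ : ∀ r n → r * n + r * n ≡ 2 * (r * n)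
      regroup₂ = solve-∀
      regroup₃ : ∀ r X s d₁ d₂ → 2 * (r * (X + s + d₁ + d₂)) ≡ 2 * (r * X) + 2 * (r * s) + (2 * r * d₁ + 2 * r * d₂)
      regroup₃ = solve-∀

  -- One greedy step: if the U uncovered tuples split as U₁ + g with U ≤ D·g,
  -- then D·U₁ + U ≤ D·U, i.e. the uncovered count drops by a factor 1 - 1/D.
  step-decay : ∀ D U U₁ g → U ≡ U₁ + g → U ≤ D * g → D * U₁ + U ≤ D * U
  step-decay D U U₁ g split U≤Dg = begin
    D * U₁ + U      ≤⟨ +-monoʳ-≤ (D * U₁) U≤Dg ⟩
    D * U₁ + D * g  ≡⟨ sym (*-distribˡ-+ D U₁ g) ⟩
    D * (U₁ + g)    ≡⟨ cong (D *_) (sym split) ⟩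
    D * U           ∎
    where open ≤-Reasoning

  round-decay : ∀ D j U U₁ U′ → D * U₁ + U ≤ D * U → (D + j) * U′ ≤ D * U₁ → U′ ≤ U₁ → U₁ ≤ U →
    (D + suc j) * U′ ≤ D * U
  round-decay D j U U₁ U′ step rest U′≤U₁ U₁≤U = begin
    (D + suc j) * U′    ≡⟨ regroup D j U′ ⟩
    (D + j) * U′ + U′   ≤⟨ +-mono-≤ rest (≤-trans U′≤U₁ U₁≤U) ⟩
    D * U₁ + U          ≤⟨ step ⟩
    D * U               ∎
    where
    open ≤-Reasoning
    regroup : ∀ D j U′ → (D + suc j) * U′ ≡ (D + j) * U′ + U′
    regroup = solve-∀

  halving : ∀ D U U₁ h .{{_ : NonZero D}} → (D + D) * U₁ ≤ D * U → U < 2 ^ suc h → U₁ < 2 ^ h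
  halving D U U₁ h decay U<2^h+1 = *-cancelˡ-< 2 U₁ (2 ^ h) (<-≤-trans (s≤s 2U₁≤U) U<2^h+1)
    where
    regroup : ∀ D U₁ → D * (2 * U₁) ≡ (D + D) * U₁
    regroup = solve-∀
    2U₁≤U : 2 * U₁ ≤ U
    2U₁≤U = *-cancelˡ-≤ D (≤-trans (≤-reflexive (regroup D U₁)) decay)

  budget : ∀ a b D h → a ≤ b + D → a + D * h ≤ b + D * suc h
  budget a b D h a≤b+D = begin
    a + D * h        ≤⟨ +-monoˡ-≤ (D * h) a≤b+D ⟩
    b + D + D * h    ≡⟨ +-assoc b D (D * h) ⟩
    b + (D + D * h)  ≡⟨ cong (b +_) (sym (*-suc D h)) ⟩
    b + D * suc h    ∎
    where open ≤-Reasoning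

module Absorption where
  open import Data.Nat
  open import Data.Nat.Properties
  open import Data.Nat.ListAction using (sum)
  open import Data.Fin using (Fin)
  open import Data.Fin.Properties using () renaming (_≟_ to _≟ᶠ_)
  open import Data.List using (List; []; _∷_; length; filter; map; concatMap; allFin)
  open import Data.List.Properties using (length-tabulate; length-filter; filter-≐)
  open import Data.List.Membership.Propositional using (_∈_; _∉_; find; lose)
  open import Data.List.Membership.Propositional.Properties using (∈-concatMap⁺; ∈-allFin; ∈-filter⁻)
  open import Data.List.Relation.Unary.Any as Any using (Any; here; there)
  open import Data.List.Relation.Unary.All as All using (All; []; _∷_)
  open import Data.List.Relation.Unary.All.Properties.Core using (¬Any⇒All¬; All¬⇒¬Any)
  open import Data.List.Relation.Unary.AllPairs using (allPairs?; []; _∷_)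
  open import Data.List.Relation.Unary.Unique.Propositional using (Unique)
  open import Data.List.Relation.Unary.Unique.Propositional.Properties using (allFin⁺; ++⁺)
  open import Data.Sum using (_⊎_; inj₁; inj₂)
  open import Data.Product using (_×_; _,_; Σ; proj₁; proj₂)
  open import Data.Unit using (tt)
  open import Data.Empty using (⊥-elim)
  open import Function using (_∘_)
  open import Level using (0ℓ)
  open import Relation.Binary.PropositionalEquality
  open import Relation.Nullary using (¬_; Dec; yes; no; contradiction)
  open import Relation.Nullary.Decidable using (_×-dec_; _⊎-dec_; ¬?)
  open import Relation.Unary using (Pred; Decidable; _≐_)
  open import Defs
  open Counting
  open Arithmetic

  -- Every monochromatic degree is at most (1/2 - 1/r) n, in integer form.
  MonDegBound : ∀ {n} → ℕ → Colouring n → Set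
  MonDegBound {n} r c = ∀ v a → 2 * r * monDeg c v a + 2 * n ≤ r * n

  module Absorbers {n : ℕ} (c : Colouring n) (c-sym : Symmetric c)
                   (r : ℕ) (low-degree : MonDegBound r c) where

    vertexList : List (Fin n)
    vertexList = allFin n

    Avoids : Fin n → List (Fin n) → Set
    Avoids z S = All (z ≢_) S

    Fresh : Fin n → ℕ → ℕ → List (Fin n) → Fin n → Set
    Fresh v a b S z = Avoids z S × c v z ≢ a × c v z ≢ b

    fresh? : (v : Fin n) (a b : ℕ) (S : List (Fin n)) → Decidable (Fresh v a b S)
    fresh? v a b S z = All.all? (λ s → ¬? (z ≟ᶠ s)) S ×-dec ¬? (c v z ≟ a) ×-dec ¬? (c v z ≟ b)

    mono? : (v : Fin n) (a : ℕ) → Decidable (λ u → u ≢ v × c v u ≡ a)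
    mono? v a u = ¬? (u ≟ᶠ v) ×-dec (c v u ≟ a)

    many-fresh : (v : Fin n) (a b : ℕ) (S : List (Fin n)) → v ∈ S → r * length S ≤ n →
      n ≤ r * count (fresh? v a b S) vertexList
    many-fresh v a b S v∈S small-S =
      fresh-arithmetic n r _ _ (monDeg c v a) (monDeg c v b) cover
        (≤-trans (*-monoʳ-≤ r (count-members _≟ᶠ_ S vertexList (allFin⁺ n))) small-S)
        (low-degree v a) (low-degree v b)
      where
      member? = λ z → Any.any? (z ≟ᶠ_) S
      coloured? = λ z → mono? v a z ⊎-dec mono? v b z
      not-fresh? = λ z → member? z ⊎-dec coloured? z
      classify : ∀ z → Fresh v a b S z ⊎ (Any (z ≡_) S ⊎ ((z ≢ v × c v z ≡ a) ⊎ (z ≢ v × c v z ≡ b)))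
      classify z with member? z
      ... | yes z∈S = inj₂ (inj₁ z∈S)
      ... | no z∉S with ¬Any⇒All¬ S z∉S | c v z ≟ a | c v z ≟ b
      ...   | avoids | yes ≡a | _     = inj₂ (inj₂ (inj₁ ((λ z≡v → All.lookup avoids v∈S z≡v) , ≡a)))
      ...   | avoids | no _   | yes ≡b = inj₂ (inj₂ (inj₂ ((λ z≡v → All.lookup avoids v∈S z≡v) , ≡b)))
      ...   | avoids | no ≢a  | no ≢b = inj₁ (avoids , ≢a , ≢b)
      F = count (fresh? v a b S) vertexList
      M = count member? vertexList
      cover : n ≤ F + M + monDeg c v a + monDeg c v b
      cover = begin
        n                                                          ≡⟨ sym (length-tabulate (λ x → x)) ⟩
        length vertexList                                          ≤⟨ length-≤-union (fresh? v a b S) not-fresh? classify vertexList ⟩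
        F + count not-fresh? vertexList                            ≤⟨ +-monoʳ-≤ F (count-union not-fresh? member? coloured? (λ _ p → p) vertexList) ⟩
        F + (M + count coloured? vertexList)                       ≤⟨ +-monoʳ-≤ F (+-monoʳ-≤ M (count-union coloured? (mono? v a) (mono? v b) (λ _ p → p) vertexList)) ⟩
        F + (M + (monDeg c v a + monDeg c v b))                    ≡⟨ cong (F +_) (sym (+-assoc M _ _)) ⟩
        F + (M + monDeg c v a + monDeg c v b)                      ≡⟨ sym (+-assoc F _ _) ⟩
        F + (M + monDeg c v a) + monDeg c v b                      ≡⟨ cong (_+ monDeg c v b) (sym (+-assoc F M _)) ⟩
        F + M + monDeg c v a + monDeg c v b                        ∎
        where
        open ≤-Reasoning

    -- All 4-tuples of vertices, enumerated in the order z₂, z₃, z₁, z₄ in which an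
    -- absorbing path z₁z₂z₃z₄ for (x₁,x₂;y₁,y₂) is grown: z₂ from x₁, z₃ from y₂, z₁ from z₂, z₄ from z₃.
    extensions₄ : Fin n → Fin n → Fin n → List (Path4 n)
    extensions₄ z₂ z₃ z₁ = concatMap (λ z₄ → (z₁ , z₂ , z₃ , z₄) ∷ []) vertexList

    extensions₃ : Fin n → Fin n → List (Path4 n)
    extensions₃ z₂ z₃ = concatMap (extensions₄ z₂ z₃) vertexList

    extensions₂ : Fin n → List (Path4 n)
    extensions₂ z₂ = concatMap (extensions₃ z₂) vertexList

    allPaths : List (Path4 n)
    allPaths = concatMap extensions₂ vertexList

    unique? : (xs : List (Fin n)) → Dec (Unique xs)
    unique? = allPairs? (λ x y → ¬? (x ≟ᶠ y))

    consecDistinct? : (xs : List (Fin n)) → Dec (ConsecDistinct c xs)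
    consecDistinct? [] = yes tt
    consecDistinct? (x ∷ []) = yes tt
    consecDistinct? (x ∷ y ∷ []) = yes tt
    consecDistinct? (x ∷ y ∷ z ∷ rest) = ¬? (c x y ≟ c y z) ×-dec consecDistinct? (y ∷ z ∷ rest)

    pcPath? : (xs : List (Fin n)) → Dec (PCPath c xs)
    pcPath? xs = unique? xs ×-dec consecDistinct? xs

    Absorbs : Path4 n → Path4 n → Set
    Absorbs (x₁ , x₂ , y₁ , y₂) P = Absorbing c x₁ x₂ y₁ y₂ P

    absorbs? : (T P : Path4 n) → Dec (Absorbs T P)
    absorbs? (x₁ , x₂ , y₁ , y₂) (z₁ , z₂ , z₃ , z₄) =
      pcPath? (z₁ ∷ z₂ ∷ z₃ ∷ z₄ ∷ []) ×-dec unique? (z₁ ∷ z₂ ∷ z₃ ∷ z₄ ∷ x₁ ∷ x₂ ∷ y₁ ∷ y₂ ∷ [])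
        ×-dec pcPath? (z₁ ∷ z₂ ∷ x₁ ∷ x₂ ∷ []) ×-dec pcPath? (y₁ ∷ y₂ ∷ z₃ ∷ z₄ ∷ [])

    Available : List (Fin n) → Path4 n → Set
    Available W P = PCPath c (vertices P) × All (_∉ W) (vertices P)

    available? : (W : List (Fin n)) → Decidable (Available W)
    available? W P = pcPath? (vertices P) ×-dec All.all? (λ z → ¬? (Any.any? (z ≟ᶠ_) W)) (vertices P)

    availableAbsorber? : (W : List (Fin n)) (T : Path4 n) → Decidable (λ P → Available W P × Absorbs T P)
    availableAbsorber? W T P = available? W P ×-dec absorbs? T P

    -- Four successive fresh choices yield an available absorbing path (a repeated colour
    -- argument of Fresh means that only one colour is forbidden).
    absorber-from-choices : (W : List (Fin n)) (x₁ x₂ y₁ y₂ z₁ z₂ z₃ z₄ : Fin n) →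
      Unique (x₁ ∷ x₂ ∷ y₁ ∷ y₂ ∷ []) →
      Fresh x₁ (c x₁ x₂) (c x₁ x₂) (x₁ ∷ x₂ ∷ y₁ ∷ y₂ ∷ W) z₂ →
      Fresh y₂ (c y₁ y₂) (c y₁ y₂) (z₂ ∷ x₁ ∷ x₂ ∷ y₁ ∷ y₂ ∷ W) z₃ →
      Fresh z₂ (c z₂ x₁) (c z₂ z₃) (z₃ ∷ z₂ ∷ x₁ ∷ x₂ ∷ y₁ ∷ y₂ ∷ W) z₁ →
      Fresh z₃ (c z₃ z₂) (c z₃ y₂) (z₁ ∷ z₃ ∷ z₂ ∷ x₁ ∷ x₂ ∷ y₁ ∷ y₂ ∷ W) z₄ →
      Available W (z₁ , z₂ , z₃ , z₄) × Absorbs (x₁ , x₂ , y₁ , y₂) (z₁ , z₂ , z₃ , z₄)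
    absorber-from-choices W x₁ x₂ y₁ y₂ z₁ z₂ z₃ z₄
      distinct@((x₁x₂ ∷ x₁y₁ ∷ x₁y₂ ∷ []) ∷ (x₂y₁ ∷ x₂y₂ ∷ []) ∷ (y₁y₂ ∷ []) ∷ [] ∷ [])
      ((z₂x₁ ∷ z₂x₂ ∷ z₂y₁ ∷ z₂y₂ ∷ z₂∉W) , x₁z₂≢x₁x₂ , _)
      ((z₃z₂ ∷ z₃x₁ ∷ z₃x₂ ∷ z₃y₁ ∷ z₃y₂ ∷ z₃∉W) , y₂z₃≢y₁y₂ , _)
      ((z₁z₃ ∷ z₁z₂ ∷ z₁x₁ ∷ z₁x₂ ∷ z₁y₁ ∷ z₁y₂ ∷ z₁∉W) , z₂z₁≢z₂x₁ , z₂z₁≢z₂z₃)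
      ((z₄z₁ ∷ z₄z₃ ∷ z₄z₂ ∷ z₄x₁ ∷ z₄x₂ ∷ z₄y₁ ∷ z₄y₂ ∷ z₄∉W) , z₃z₄≢z₃z₂ , z₃z₄≢z₃y₂) =
      (path , All¬⇒¬Any z₁∉W ∷ All¬⇒¬Any z₂∉W ∷ All¬⇒¬Any z₃∉W ∷ All¬⇒¬Any z₄∉W ∷ []) ,
      path , (distinct-z ∷ distinct-z₂ ∷ distinct-z₃ ∷ distinct-z₄ ∷ distinct) , front , back
      where
      -- colours are read off in whichever orientation the fresh choices fixed them
      z₁z₂≢z₂z₃ : c z₁ z₂ ≢ c z₂ z₃
      z₁z₂≢z₂z₃ e = z₂z₁≢z₂z₃ (trans (c-sym z₂ z₁ (≢-sym z₁z₂)) e)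
      z₂z₃≢z₃z₄ : c z₂ z₃ ≢ c z₃ z₄
      z₂z₃≢z₃z₄ e = z₃z₄≢z₃z₂ (trans (sym e) (c-sym z₂ z₃ (≢-sym z₃z₂)))
      path : PCPath c (z₁ ∷ z₂ ∷ z₃ ∷ z₄ ∷ [])
      path = ((z₁z₂ ∷ z₁z₃ ∷ ≢-sym z₄z₁ ∷ []) ∷ (≢-sym z₃z₂ ∷ ≢-sym z₄z₂ ∷ []) ∷ (≢-sym z₄z₃ ∷ []) ∷ [] ∷ []) ,
             z₁z₂≢z₂z₃ , z₂z₃≢z₃z₄ , tt
      distinct-z = z₁z₂ ∷ z₁z₃ ∷ ≢-sym z₄z₁ ∷ z₁x₁ ∷ z₁x₂ ∷ z₁y₁ ∷ z₁y₂ ∷ []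
      distinct-z₂ = ≢-sym z₃z₂ ∷ ≢-sym z₄z₂ ∷ z₂x₁ ∷ z₂x₂ ∷ z₂y₁ ∷ z₂y₂ ∷ []
      distinct-z₃ = ≢-sym z₄z₃ ∷ z₃x₁ ∷ z₃x₂ ∷ z₃y₁ ∷ z₃y₂ ∷ []
      distinct-z₄ = z₄x₁ ∷ z₄x₂ ∷ z₄y₁ ∷ z₄y₂ ∷ []
      front : PCPath c (z₁ ∷ z₂ ∷ x₁ ∷ x₂ ∷ [])
      front = ((z₁z₂ ∷ z₁x₁ ∷ z₁x₂ ∷ []) ∷ (z₂x₁ ∷ z₂x₂ ∷ []) ∷ (x₁x₂ ∷ []) ∷ [] ∷ []) ,
              (λ e → z₂z₁≢z₂x₁ (trans (c-sym z₂ z₁ (≢-sym z₁z₂)) e)) ,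
              (λ e → x₁z₂≢x₁x₂ (trans (c-sym x₁ z₂ (≢-sym z₂x₁)) e)) , tt
      back : PCPath c (y₁ ∷ y₂ ∷ z₃ ∷ z₄ ∷ [])
      back = ((y₁y₂ ∷ ≢-sym z₃y₁ ∷ ≢-sym z₄y₁ ∷ []) ∷ (≢-sym z₃y₂ ∷ ≢-sym z₄y₂ ∷ []) ∷ (≢-sym z₄z₃ ∷ []) ∷ [] ∷ []) ,
             (λ e → y₂z₃≢y₁y₂ (sym e)) ,
             (λ e → z₃z₄≢z₃y₂ (trans (sym e) (c-sym y₂ z₃ (≢-sym z₃y₂)))) , tt

    count-layer : {B : Set} {P : Pred B 0ℓ} (P? : Decidable P) (f : Fin n → List B)
      {G : Pred (Fin n) 0ℓ} (G? : Decidable G) (j : ℕ) → n ≤ r * count G? vertexList →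
      (∀ z → G z → n ^ j ≤ r ^ j * count P? (f z)) →
      n ^ suc j ≤ r ^ suc j * count P? (concatMap f vertexList)
    count-layer P? f G? j many-good completions = begin
      n * n ^ j                                              ≤⟨ *-monoˡ-≤ (n ^ j) many-good ⟩
      r * count G? vertexList * n ^ j                        ≡⟨ *-assoc r _ _ ⟩
      r * (count G? vertexList * n ^ j)                      ≤⟨ *-monoʳ-≤ r (sum-≥-count G? (λ z → r ^ j * extensions z) (n ^ j) completions vertexList) ⟩
      r * sum (map (λ z → r ^ j * extensions z) vertexList)  ≡⟨ cong (r *_) (sum-scale (r ^ j) extensions vertexList) ⟩
      r * (r ^ j * sum (map extensions vertexList))          ≡⟨ sym (*-assoc r _ _) ⟩
      r * r ^ j * sum (map extensions vertexList)            ≡⟨ cong (r * r ^ j *_) (sym (count-concatMap P? f vertexList)) ⟩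
      r * r ^ j * count P? (concatMap f vertexList)          ∎
      where
      open ≤-Reasoning
      extensions : Fin n → ℕ
      extensions z = count P? (f z)

    counted : {B : Set} {P : Pred B 0ℓ} (P? : Decidable P) {x : B} → P x → n ^ 0 ≤ r ^ 0 * count P? (x ∷ [])
    counted P? {x} px with P? x
    ... | yes _  = s≤s z≤n
    ... | no ¬px = ⊥-elim (¬px px)

    -- Every 4-tuple of distinct vertices has at least (n/r)^4 absorbing paths avoiding a
    -- small set W: choose z₂, z₃, z₁, z₄ in turn, each time among at least n/r fresh vertices.
    many-absorbers : (W : List (Fin n)) (x₁ x₂ y₁ y₂ : Fin n) → Unique (x₁ ∷ x₂ ∷ y₁ ∷ y₂ ∷ []) →
      r * (7 + length W) ≤ n → n ^ 4 ≤ r ^ 4 * count (availableAbsorber? W (x₁ , x₂ , y₁ , y₂)) allPaths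
    many-absorbers W x₁ x₂ y₁ y₂ distinct small-W =
      count-layer good extensions₂ (fresh? x₁ a a S₂) 3 (many-fresh x₁ a a S₂ (here refl) (small 4 (m≤m+n 4 3))) λ z₂ f₂ →
      count-layer good (extensions₃ z₂) (fresh? y₂ b b (z₂ ∷ S₂)) 2
        (many-fresh y₂ b b (z₂ ∷ S₂) (there (there (there (there (here refl))))) (small 5 (m≤m+n 5 2))) λ z₃ f₃ →
      count-layer good (extensions₄ z₂ z₃) (fresh? z₂ (c z₂ x₁) (c z₂ z₃) (z₃ ∷ z₂ ∷ S₂)) 1
        (many-fresh z₂ _ _ (z₃ ∷ z₂ ∷ S₂) (there (here refl)) (small 6 (m≤m+n 6 1))) λ z₁ f₁ →
      count-layer good (λ z₄ → (z₁ , z₂ , z₃ , z₄) ∷ []) (fresh? z₃ (c z₃ z₂) (c z₃ y₂) (z₁ ∷ z₃ ∷ z₂ ∷ S₂)) 0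
        (many-fresh z₃ _ _ (z₁ ∷ z₃ ∷ z₂ ∷ S₂) (there (here refl)) (small 7 ≤-refl)) λ z₄ f₄ →
      counted good (absorber-from-choices W x₁ x₂ y₁ y₂ z₁ z₂ z₃ z₄ distinct f₂ f₃ f₁ f₄)
      where
      a = c x₁ x₂
      b = c y₁ y₂
      S₂ = x₁ ∷ x₂ ∷ y₁ ∷ y₂ ∷ W
      good = availableAbsorber? W (x₁ , x₂ , y₁ , y₂)
      small : ∀ m → m ≤ 7 → r * (m + length W) ≤ n
      small m m≤7 = ≤-trans (*-monoʳ-≤ r (+-monoˡ-≤ (length W) m≤7)) small-W

    length-vertexList : length vertexList ≡ n
    length-vertexList = length-tabulate (λ x → x)

    length-concatMap-vertexList : {B : Set} (f : Fin n → List B) {k : ℕ} →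
      (∀ z → length (f z) ≡ k) → length (concatMap f vertexList) ≡ n * k
    length-concatMap-vertexList f {k} len =
      trans (length-concatMap f k len vertexList) (cong (_* k) length-vertexList)

    length-allPaths : length allPaths ≡ n ^ 4
    length-allPaths =
      length-concatMap-vertexList extensions₂ λ z₂ →
      length-concatMap-vertexList (extensions₃ z₂) λ z₃ →
      length-concatMap-vertexList (extensions₄ z₂ z₃) λ z₁ →
      length-concatMap-vertexList (λ z₄ → (z₁ , z₂ , z₃ , z₄) ∷ []) λ _ → refl

    count-allPaths-≤ : {Q : Pred (Path4 n) 0ℓ} (Q? : Decidable Q) → count Q? allPaths ≤ n ^ 4
    count-allPaths-≤ Q? = ≤-trans (length-filter Q? allPaths) (≤-reflexive length-allPaths)

    ∈-allPaths : (P : Path4 n) → P ∈ allPaths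
    ∈-allPaths (z₁ , z₂ , z₃ , z₄) =
      ∈-concatMap⁺ extensions₂ (lose (∈-allFin z₂)
        (∈-concatMap⁺ (extensions₃ z₂) (lose (∈-allFin z₃)
          (∈-concatMap⁺ (extensions₄ z₂ z₃) (lose (∈-allFin z₁)
            (∈-concatMap⁺ (λ z₄ → (z₁ , z₂ , z₃ , z₄) ∷ []) (lose (∈-allFin z₄) (here refl))))))))

    Uncovered : List (Path4 n) → Path4 n → Set
    Uncovered F T = Unique (vertices T) × ¬ Any (Absorbs T) F

    uncovered? : (F : List (Path4 n)) → Decidable (Uncovered F)
    uncovered? F T = unique? (vertices T) ×-dec ¬? (Any.any? (absorbs? T) F)

    uncoveredCount : List (Path4 n) → ℕ
    uncoveredCount F = count (uncovered? F) allPaths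

    gain : List (Path4 n) → Path4 n → ℕ
    gain F P = count (λ T → uncovered? F T ×-dec absorbs? T P) allPaths

    uncovered-split : (F : List (Path4 n)) (P : Path4 n) →
      uncoveredCount F ≡ uncoveredCount (P ∷ F) + gain F P
    uncovered-split F P = begin
      uncoveredCount F                                         ≡⟨ count-split (uncovered? F) (λ T → absorbs? T P) allPaths ⟩
      gain F P + count (λ T → uncovered? F T ×-dec ¬? (absorbs? T P)) allPaths
                                                               ≡⟨ +-comm (gain F P) _ ⟩
      count (λ T → uncovered? F T ×-dec ¬? (absorbs? T P)) allPaths + gain F P
                                                               ≡⟨ cong (λ xs → length xs + gain F P) (filter-≐ _ (uncovered? (P ∷ F)) same allPaths) ⟩
      uncoveredCount (P ∷ F) + gain F P                        ∎
      where
      open ≡-Reasoning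
      same : (λ T → Uncovered F T × ¬ Absorbs T P) ≐ Uncovered (P ∷ F)
      same = (λ { ((distinct , ¬covered) , ¬absorbed) → distinct , λ { (here a) → ¬absorbed a ; (there a) → ¬covered a } })
           , (λ { (distinct , ¬covered) → (distinct , ¬covered ∘ there) , ¬covered ∘ here })

    familyVertices : List (Path4 n) → List (Fin n)
    familyVertices = concatMap vertices

    candidates : List (Path4 n) → List (Path4 n)
    candidates F = filter (available? (familyVertices F)) allPaths

    extend-family : (F : List (Path4 n)) (P : Path4 n) → VertexDisjointPCFamily c F →
      Available (familyVertices F) P → VertexDisjointPCFamily c (P ∷ F)
    extend-family F P (paths , disjoint) (path , outside) =
      (λ { _ (here refl) → path ; Q (there Q∈F) → paths Q Q∈F }) ,
      ++⁺ (proj₁ path) disjoint (λ (v∈P , v∈F) → All.lookup outside v∈P v∈F)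

    -- The family has room for k paths: r·(7 + 4k) ≤ n, so that 4k used vertices plus the
    -- at most 7 vertices of a tuple and a partial absorber form a set S with r·|S| ≤ n.
    Room : ℕ → Set
    Room k = r * (7 + k * 4) ≤ n

    shrink-room : ∀ {a b} → a ≤ b → Room b → Room a
    shrink-room a≤b room = ≤-trans (*-monoʳ-≤ r (+-monoʳ-≤ 7 (*-monoˡ-≤ 4 a≤b))) room

    -- While the family is small, each uncovered tuple has at least (n/r)^4 candidate absorbers,
    -- so by double counting the candidates gain at least U(F)·(n/r)^4 in total.
    total-gain : (F : List (Path4 n)) → Room (length F) →
      uncoveredCount F * n ^ 4 ≤ r ^ 4 * sum (map (gain F) (candidates F))
    total-gain F small-F = begin
      uncoveredCount F * n ^ 4                        ≤⟨ sum-≥-count (uncovered? F) (λ T → r ^ 4 * absorbers T) (n ^ 4) many allPaths ⟩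
      sum (map (λ T → r ^ 4 * absorbers T) allPaths)  ≡⟨ sum-scale (r ^ 4) absorbers allPaths ⟩
      r ^ 4 * sum (map absorbers allPaths)            ≡⟨ cong (r ^ 4 *_) (sym (count-swap gains (candidates F) allPaths)) ⟩
      r ^ 4 * sum (map (gain F) (candidates F))       ∎
      where
      open ≤-Reasoning
      W = familyVertices F
      gains : (P T : Path4 n) → Dec (Uncovered F T × Absorbs T P)
      gains P T = uncovered? F T ×-dec absorbs? T P
      absorbers : Path4 n → ℕ
      absorbers T = count (λ P → gains P T) (candidates F)
      small-W : r * (7 + length W) ≤ n
      small-W = subst (λ k → r * (7 + k) ≤ n) (sym (length-concatMap vertices 4 (λ _ → refl) F)) small-F
      many : ∀ T → Uncovered F T → n ^ 4 ≤ r ^ 4 * absorbers T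
      many T@(x₁ , x₂ , y₁ , y₂) uncovered@(distinct , _) = begin
        n ^ 4                                             ≤⟨ many-absorbers W x₁ x₂ y₁ y₂ distinct small-W ⟩
        r ^ 4 * count (availableAbsorber? W T) allPaths   ≡⟨ cong (r ^ 4 *_) (sym (count-filter (absorbs? T) (available? W) allPaths)) ⟩
        r ^ 4 * count (absorbs? T) (candidates F)         ≤⟨ *-monoʳ-≤ (r ^ 4) (count-mono (absorbs? T) (λ P → gains P T) (λ _ a → uncovered , a) (candidates F)) ⟩
        r ^ 4 * absorbers T                               ∎

    -- While some tuple is uncovered, a candidate absorbs at least a 1/r^4 fraction of the
    -- uncovered tuples: average the gains over the at most n^4 candidates and use total-gain.
    best-candidate : (F : List (Path4 n)) → Room (length F) → 0 < uncoveredCount F →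
      Σ (Path4 n) λ P → P ∈ candidates F × uncoveredCount F ≤ r ^ 4 * gain F P
    best-candidate F room some-uncovered with averaging (gain F) (candidates F)
    ... | inj₂ total≡0 =
      contradiction (≤-trans (*-mono-≤ some-uncovered (<-≤-trans some-uncovered (count-allPaths-≤ (uncovered? F))))
                      (≤-trans (total-gain F room) (≤-reflexive (trans (cong (r ^ 4 *_) total≡0) (*-zeroʳ (r ^ 4))))))
                    λ ()
    ... | inj₁ (P , P∈ , above-average) =
      P , P∈ , *-cancelʳ-≤ (uncoveredCount F) (r ^ 4 * g) (n ^ 4) {{>-nonZero n⁴>0}} (begin
        uncoveredCount F * n ^ 4                  ≤⟨ total-gain F room ⟩
        r ^ 4 * sum (map (gain F) (candidates F)) ≤⟨ *-monoʳ-≤ (r ^ 4) above-average ⟩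
        r ^ 4 * (length (candidates F) * g)       ≤⟨ *-monoʳ-≤ (r ^ 4) (*-monoˡ-≤ g (count-allPaths-≤ _)) ⟩
        r ^ 4 * (n ^ 4 * g)                       ≡⟨ cong (r ^ 4 *_) (*-comm (n ^ 4) g) ⟩
        r ^ 4 * (g * n ^ 4)                       ≡⟨ sym (*-assoc (r ^ 4) g (n ^ 4)) ⟩
        r ^ 4 * g * n ^ 4                         ∎)
      where
      open ≤-Reasoning
      g = gain F P
      n⁴>0 = <-≤-trans some-uncovered (count-allPaths-≤ (uncovered? F))

    greedy-step : (F : List (Path4 n)) → VertexDisjointPCFamily c F → Room (length F) →
      0 < uncoveredCount F →
      Σ (Path4 n) λ P → VertexDisjointPCFamily c (P ∷ F) × uncoveredCount F ≤ r ^ 4 * gain F P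
    greedy-step F family room some-uncovered =
      let P , P∈ , large-gain = best-candidate F room some-uncovered
      in P , extend-family F P family (proj₂ (∈-filter⁻ (available? (familyVertices F)) {xs = allPaths} P∈)) , large-gain

    greedy-rounds : (j : ℕ) (F : List (Path4 n)) → VertexDisjointPCFamily c F → Room (length F + j) →
      Σ (List (Path4 n)) λ F′ → VertexDisjointPCFamily c F′ × length F′ ≤ length F + j ×
        (r ^ 4 + j) * uncoveredCount F′ ≤ r ^ 4 * uncoveredCount F × uncoveredCount F′ ≤ uncoveredCount F
    greedy-rounds zero F family _ =
      F , family , m≤m+n _ 0 , ≤-reflexive (cong (_* uncoveredCount F) (+-identityʳ (r ^ 4))) , ≤-refl
    greedy-rounds (suc j) F family room with uncoveredCount F ≟ 0
    ... | yes none =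
      F , family , m≤m+n _ _ ,
      subst (λ u → (r ^ 4 + suc j) * u ≤ r ^ 4 * u) (sym none) (≤-reflexive (trans (*-zeroʳ (r ^ 4 + suc j)) (sym (*-zeroʳ (r ^ 4))))) ,
      ≤-refl
    ... | no some =
      let P , family₁ , large-gain = greedy-step F family (shrink-room (m≤m+n (length F) (suc j)) room) (n≢0⇒n>0 some)
          F′ , family′ , length′ , decay′ , U′≤U₁ = greedy-rounds j (P ∷ F) family₁ (subst Room (+-suc (length F) j) room)
          step = step-decay (r ^ 4) _ _ (gain F P) (uncovered-split F P) large-gain
          U₁≤U = ≤-trans (m≤m+n _ _) (≤-reflexive (sym (uncovered-split F P)))
      in F′ , family′ , ≤-trans length′ (≤-reflexive (sym (+-suc _ _))) ,
         round-decay (r ^ 4) j _ _ _ step decay′ U′≤U₁ U₁≤U , ≤-trans U′≤U₁ U₁≤U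

    -- r^4 greedy steps at least halve the uncovered count; hence r^4·h steps
    -- cover everything once fewer than 2^h tuples are uncovered.
    greedy-cover : (h : ℕ) (F : List (Path4 n)) → 0 < r → VertexDisjointPCFamily c F →
      Room (length F + r ^ 4 * h) → uncoveredCount F < 2 ^ h →
      Σ (List (Path4 n)) λ F′ → VertexDisjointPCFamily c F′ × length F′ ≤ length F + r ^ 4 * h × uncoveredCount F′ ≡ 0
    greedy-cover zero F _ family _ few = F , family , m≤m+n _ _ , n<1⇒n≡0 few
    greedy-cover (suc h) F r>0 family room few =
      let F₁ , family₁ , length₁ , decay , _ = greedy-rounds (r ^ 4) F family (shrink-room first-rounds room)
          F′ , family′ , length′ , covered = greedy-cover h F₁ r>0 family₁ (shrink-room (budget _ _ (r ^ 4) h length₁) room)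
                                               (halving (r ^ 4) _ _ h {{m^n≢0 r 4 {{>-nonZero r>0}}}} decay few)
      in F′ , family′ , ≤-trans length′ (budget _ _ (r ^ 4) h length₁) , covered
      where
      first-rounds : length F + r ^ 4 ≤ length F + r ^ 4 * suc h
      first-rounds = +-monoʳ-≤ (length F) (≤-trans (m≤m+n (r ^ 4) (r ^ 4 * h)) (≤-reflexive (sym (*-suc (r ^ 4) h))))

    AbsorbsAll : List (Path4 n) → Set
    AbsorbsAll F = ∀ (x₁ x₂ y₁ y₂ : Fin n) → Unique (x₁ ∷ x₂ ∷ y₁ ∷ y₂ ∷ []) →
      Σ (Path4 n) λ P → P ∈ F × Absorbing c x₁ x₂ y₁ y₂ P

    absorbs-all : (F : List (Path4 n)) → uncoveredCount F ≡ 0 → AbsorbsAll F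
    absorbs-all F none x₁ x₂ y₁ y₂ distinct with Any.any? (absorbs? (x₁ , x₂ , y₁ , y₂)) F
    ... | yes absorbed = find absorbed
    ... | no ¬absorbed = ⊥-elim (count-zero (uncovered? F) allPaths none (∈-allPaths _) (distinct , ¬absorbed))

    absorbing-family : (h : ℕ) → 0 < r → Room (r ^ 4 * h) → n ^ 4 < 2 ^ h →
      Σ (List (Path4 n)) λ F → VertexDisjointPCFamily c F × length F ≤ r ^ 4 * h × AbsorbsAll F
    absorbing-family h r>0 room n⁴<2^h
      with greedy-cover h [] r>0 ((λ _ ()) , []) room (≤-<-trans (count-allPaths-≤ (uncovered? [])) n⁴<2^h)
    ... | F , family , size , none = F , family , size , absorbs-all F none

module Numerics where
  open import Data.Nat
  open import Data.Nat.Properties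
  open import Data.Nat.Tactic.RingSolver using (solve-∀)
  open import Data.Product using (_×_; _,_; Σ)
  open import Relation.Binary.PropositionalEquality
  open import Relation.Nullary using (yes; no)

  binary-length : ∀ k → Σ ℕ λ b′ → suc k < 2 ^ suc b′ × 2 ^ suc b′ ≤ 2 * suc k
  binary-length zero = 0 , ≤-refl , ≤-refl
  binary-length (suc k) with binary-length k
  ... | b′ , below , bracket with suc (suc k) <? 2 ^ suc b′
  ...   | yes still-below = b′ , still-below , ≤-trans bracket (*-monoʳ-≤ 2 (n≤1+n (suc k)))
  ...   | no reached = suc b′ , ≤-trans (≤-reflexive (cong suc power)) (2^-strict (suc b′)) , ≤-reflexive (cong (2 *_) (sym power))
    where
    power : suc (suc k) ≡ 2 ^ suc b′
    power = ≤-antisym below (≮⇒≥ reached)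
    2^-strict : ∀ m → suc (2 ^ m) ≤ 2 ^ suc m
    2^-strict m = ≤-trans (+-monoˡ-≤ (2 ^ m) (m^n>0 2 m)) (≤-reflexive (cong (2 ^ m +_) (sym (+-identityʳ (2 ^ m)))))

  linear-below-exponential : ∀ K b → K * b ≤ 2 ^ b + K * K
  linear-below-exponential K zero = ≤-trans (≤-reflexive (*-zeroʳ K)) z≤n
  linear-below-exponential K (suc b) with b <? K
  ... | yes b<K = ≤-trans (*-monoʳ-≤ K b<K) (m≤n+m (K * K) (2 ^ suc b))
  ... | no b≮K = begin
      K * suc b              ≡⟨ *-suc K b ⟩
      K + K * b              ≤⟨ +-mono-≤ K≤2^b (linear-below-exponential K b) ⟩
      2 ^ b + (2 ^ b + K * K) ≡⟨ regroup (2 ^ b) (K * K) ⟩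
      2 ^ suc b + K * K      ∎
    where
    open ≤-Reasoning
    K≤2^b : K ≤ 2 ^ b
    K≤2^b = ≤-trans (≮⇒≥ b≮K) (<⇒≤ (m<2^m b))
      where
      m<2^m : ∀ m → m < 2 ^ m
      m<2^m zero = s≤s z≤n
      m<2^m (suc m) = +-mono-≤-< (m^n>0 2 m) (≤-trans (m<2^m m) (m≤m+n (2 ^ m) 0))
    regroup : ∀ x y → x + (x + y) ≡ 2 * x + y
    regroup = solve-∀

  log-bound : ∀ K n b → 8 * (K * K) ≤ n → 2 ^ b ≤ 2 * n → K * b ≤ n
  log-bound K n b large bracket = *-cancelˡ-≤ 4 (begin
    4 * (K * b)              ≡⟨ regroup₁ K b ⟩
    (4 * K) * b              ≤⟨ linear-below-exponential (4 * K) b ⟩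
    2 ^ b + 4 * K * (4 * K)  ≤⟨ +-mono-≤ bracket (≤-trans (≤-reflexive (regroup₂ K)) (*-monoʳ-≤ 2 large)) ⟩
    2 * n + 2 * n            ≡⟨ regroup₃ n ⟩
    4 * n                    ∎)
    where
    open ≤-Reasoning
    regroup₁ : ∀ K b → 4 * (K * b) ≡ 4 * K * b
    regroup₁ = solve-∀
    regroup₂ : ∀ K → 4 * K * (4 * K) ≡ 2 * (8 * (K * K))
    regroup₂ = solve-∀
    regroup₃ : ∀ n → 2 * n + 2 * n ≡ 4 * n
    regroup₃ = solve-∀

  -- The constant K(r) for which K·log₂ n ≤ n makes both size constraints hold.
  logCoefficient : ℕ → ℕ
  logCoefficient r = 512 * (r * r * r ^ 4) + 16 * (r * r ^ 4) + 7 * r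

  threshold : ℕ → ℕ
  threshold r = suc (8 * (logCoefficient r * logCoefficient r))

  -- For n beyond the threshold, h = 4·b rounds (b the binary length of n) satisfy
  -- the room constraint, the size constraint 128·r²·r^4·h ≤ n, and n^4 < 2^h.
  rounds-exist : ∀ r n → threshold r ≤ n → Σ ℕ λ h →
    r * (7 + r ^ 4 * h * 4) ≤ n × 128 * (r * r) * (r ^ 4 * h) ≤ n × n ^ 4 < 2 ^ h
  rounds-exist r (suc k) (s≤s large) with binary-length k
  ... | b′ , below , bracket =
    h , ≤-trans (m≤m+n _ _) (≤-trans (≤-reflexive (sym (room-split r (r ^ 4) b′))) Kb≤n)
      , ≤-trans (m≤m+n _ _) (≤-trans (≤-reflexive (sym (size-split r (r ^ 4) b′))) Kb≤n)
      , subst (suc k ^ 4 <_) (^-*-assoc 2 (suc b′) 4) (^-monoˡ-< 4 below)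
    where
    h = suc b′ * 4
    Kb≤n : logCoefficient r * suc b′ ≤ suc k
    Kb≤n = log-bound (logCoefficient r) (suc k) (suc b′) (≤-trans large (n≤1+n k)) bracket
    room-split : ∀ r q b′ → (512 * (r * r * q) + 16 * (r * q) + 7 * r) * suc b′ ≡
      r * (7 + q * (suc b′ * 4) * 4) + (512 * (r * r * q) * suc b′ + 7 * r * b′)
    room-split = solve-∀
    size-split : ∀ r q b′ → (512 * (r * r * q) + 16 * (r * q) + 7 * r) * suc b′ ≡
      128 * (r * r) * (q * (suc b′ * 4)) + (16 * (r * q) * suc b′ + 7 * r * suc b′)
    size-split = solve-∀

module RationalBounds where
  open import Data.Nat as ℕ using (suc; zero)
  open import Data.Integer as ℤ using (+_; +[1+_]; -[1+_])
  open import Data.Rational using (module ℚ; mkℚ; _/_; _<_; _≤_; _*_; _-_; -_; ½; 0ℚ; toℚᵘ; *<*)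
  open import Data.Rational.Properties using (↥p/↧p≡p; toℚᵘ-mono-≤; toℚᵘ-cancel-≤; toℚᵘ-homo-*; toℚᵘ-homo-+)
  open import Data.Rational.Unnormalised as ℚᵘ using (mkℚᵘ; *≤*)
  import Data.Rational.Unnormalised.Properties as ℚᵘ
  open import Data.Nat.Coprimality using (1-coprimeTo) renaming (sym to coprime-sym)
  import Data.Nat.Properties as ℕ
  import Data.Integer.Properties as ℤ
  import Data.Nat.Tactic.RingSolver as ℕ-Solver
  import Data.Integer.Tactic.RingSolver as ℤ-Solver
  open import Relation.Binary.PropositionalEquality
  open import Defs

  toℚᵘ-toℚ : ∀ m → toℚᵘ (toℚ m) ≡ mkℚᵘ (+ m) 0
  toℚᵘ-toℚ m = cong toℚᵘ (↥p/↧p≡p (mkℚ (+ m) 0 (coprime-sym (1-coprimeTo m))))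

  -- Write ε = p/r in lowest terms, so ε ≥ 1/r. Then M ≤ (1/2 - ε)·n forces
  -- M ≤ (1/2 - 1/r)·n, i.e. 2rM + 2n ≤ rn.
  degree-bound : ∀ M n ε → 0ℚ < ε → toℚ M ≤ (½ - ε) * toℚ n →
    2 ℕ.* ℚ.denominatorℕ ε ℕ.* M ℕ.+ 2 ℕ.* n ℕ.≤ ℚ.denominatorℕ ε ℕ.* n
  degree-bound M n ε@(mkℚ +[1+ p ] r-1 _) _ M≤ = cross-multiplied (unfolded (toℚᵘ-mono-≤ M≤))
    where
    r = suc r-1
    unfolded : toℚᵘ (toℚ M) ℚᵘ.≤ toℚᵘ ((½ - ε) * toℚ n) →
      mkℚᵘ (+ M) 0 ℚᵘ.≤ (toℚᵘ ½ ℚᵘ.+ toℚᵘ (- ε)) ℚᵘ.* mkℚᵘ (+ n) 0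
    unfolded M≤ᵘ = subst (ℚᵘ._≤ _) (toℚᵘ-toℚ M)
      (ℚᵘ.≤-respʳ-≃ (ℚᵘ.≃-trans (toℚᵘ-homo-* (½ - ε) (toℚ n))
                      (ℚᵘ.*-cong (toℚᵘ-homo-+ ½ (- ε)) (ℚᵘ.≃-reflexive (toℚᵘ-toℚ n)))) M≤ᵘ)
    cross-multiplied : mkℚᵘ (+ M) 0 ℚᵘ.≤ (toℚᵘ ½ ℚᵘ.+ toℚᵘ (- ε)) ℚᵘ.* mkℚᵘ (+ n) 0 →
      2 ℕ.* r ℕ.* M ℕ.+ 2 ℕ.* n ℕ.≤ r ℕ.* n
    cross-multiplied (*≤* M·2r≤[r-2p]n) = ℤ.drop‿+≤+ (begin
      + (2 ℕ.* r ℕ.* M ℕ.+ 2 ℕ.* n)             ≤⟨ ℤ.+≤+ (ℕ.+-monoʳ-≤ (2 ℕ.* r ℕ.* M) (ℕ.*-monoˡ-≤ n (ℕ.*-monoʳ-≤ 2 {1} {suc p} (ℕ.s≤s ℕ.z≤n)))) ⟩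
      + (2 ℕ.* r ℕ.* M ℕ.+ 2 ℕ.* suc p ℕ.* n)   ≡⟨ ℤ.pos-+ (2 ℕ.* r ℕ.* M) (2 ℕ.* suc p ℕ.* n) ⟩
      + (2 ℕ.* r ℕ.* M) ℤ.+ + (2 ℕ.* suc p ℕ.* n) ≡⟨ cong₂ ℤ._+_ (trans (cong +_ (ℕ-regroup r M)) (ℤ.pos-* M (2 ℕ.* r ℕ.* 1)))
                                                                  (trans (ℤ.pos-* (2 ℕ.* suc p) n) (cong (ℤ._* + n) (ℤ.pos-* 2 (suc p)))) ⟩
      + M ℤ.* + (2 ℕ.* r ℕ.* 1) ℤ.+ + 2 ℤ.* + suc p ℤ.* + n
                                                ≤⟨ ℤ.+-monoˡ-≤ (+ 2 ℤ.* + suc p ℤ.* + n) M·2r≤[r-2p]n ⟩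
      ((+ 1 ℤ.* + r ℤ.+ -[1+ p ] ℤ.* + 2) ℤ.* + n) ℤ.* + 1 ℤ.+ + 2 ℤ.* + suc p ℤ.* + n
                                                ≡⟨ ℤ-regroup (+ r) (+ suc p) (+ n) ⟩
      + r ℤ.* + n                               ≡⟨ sym (ℤ.pos-* r n) ⟩
      + (r ℕ.* n)                               ∎)
      where
      open ℤ.≤-Reasoning
      ℕ-regroup : ∀ r M → 2 ℕ.* r ℕ.* M ≡ M ℕ.* (2 ℕ.* r ℕ.* 1)
      ℕ-regroup = ℕ-Solver.solve-∀
      ℤ-regroup : ∀ R P N → ((+ 1 ℤ.* R ℤ.+ (ℤ.- P) ℤ.* + 2) ℤ.* N) ℤ.* + 1 ℤ.+ + 2 ℤ.* P ℤ.* N ≡ R ℤ.* N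
      ℤ-regroup = ℤ-Solver.solve-∀
  degree-bound M n (mkℚ (+ zero) _ _) (*<* (ℤ.+<+ ())) _
  degree-bound M n (mkℚ -[1+ _ ] _ _) (*<* ()) _

  -- Conversely, with ε = p/r ≥ 1/r, a count L with 128 r² L ≤ n satisfies L ≤ (ε²/128)·n.
  size-bound : ∀ L n ε → 0ℚ < ε → 128 ℕ.* (ℚ.denominatorℕ ε ℕ.* ℚ.denominatorℕ ε) ℕ.* L ℕ.≤ n →
    toℚ L ≤ ((+ 1 / 128) * (ε * ε)) * toℚ n
  size-bound L n ε@(mkℚ +[1+ p ] r-1 _) _ 128r²L≤n =
    toℚᵘ-cancel-≤ (subst (ℚᵘ._≤ _) (sym (toℚᵘ-toℚ L)) (ℚᵘ.≤-respʳ-≃ (ℚᵘ.≃-sym unfold) (*≤* cross-multiplied)))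
    where
    r = suc r-1
    unfold : toℚᵘ (((+ 1 / 128) * (ε * ε)) * toℚ n) ℚᵘ.≃ (toℚᵘ (+ 1 / 128) ℚᵘ.* (toℚᵘ ε ℚᵘ.* toℚᵘ ε)) ℚᵘ.* mkℚᵘ (+ n) 0
    unfold = ℚᵘ.≃-trans (toℚᵘ-homo-* ((+ 1 / 128) * (ε * ε)) (toℚ n))
               (ℚᵘ.*-cong (ℚᵘ.≃-trans (toℚᵘ-homo-* (+ 1 / 128) (ε * ε)) (ℚᵘ.*-cong (ℚᵘ.≃-refl {toℚᵘ (+ 1 / 128)}) (toℚᵘ-homo-* ε ε)))
                          (ℚᵘ.≃-reflexive (toℚᵘ-toℚ n)))
    cross-multiplied : + L ℤ.* + (128 ℕ.* (r ℕ.* r) ℕ.* 1) ℤ.≤ ((+ 1 ℤ.* (+[1+ p ] ℤ.* +[1+ p ])) ℤ.* + n) ℤ.* + 1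
    cross-multiplied = begin
      + L ℤ.* + (128 ℕ.* (r ℕ.* r) ℕ.* 1)   ≡⟨ sym (ℤ.pos-* L _) ⟩
      + (L ℕ.* (128 ℕ.* (r ℕ.* r) ℕ.* 1))   ≡⟨ cong +_ (ℕ-regroup r L) ⟩
      + (128 ℕ.* (r ℕ.* r) ℕ.* L)           ≤⟨ ℤ.+≤+ (ℕ.≤-trans 128r²L≤n (ℕ.m≤n*m n (suc p ℕ.* suc p))) ⟩
      + (suc p ℕ.* suc p ℕ.* n)             ≡⟨ trans (ℤ.pos-* (suc p ℕ.* suc p) n) (cong (ℤ._* + n) (ℤ.pos-* (suc p) (suc p))) ⟩
      + suc p ℤ.* + suc p ℤ.* + n           ≡⟨ ℤ-regroup (+ suc p) (+ n) ⟩
      ((+ 1 ℤ.* (+[1+ p ] ℤ.* +[1+ p ])) ℤ.* + n) ℤ.* + 1 ∎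
      where
      open ℤ.≤-Reasoning
      ℕ-regroup : ∀ r L → L ℕ.* (128 ℕ.* (r ℕ.* r) ℕ.* 1) ≡ 128 ℕ.* (r ℕ.* r) ℕ.* L
      ℕ-regroup = ℕ-Solver.solve-∀
      ℤ-regroup : ∀ P N → P ℤ.* P ℤ.* N ≡ ((+ 1 ℤ.* (P ℤ.* P)) ℤ.* N) ℤ.* + 1
      ℤ-regroup = ℤ-Solver.solve-∀
  size-bound L n (mkℚ (+ zero) _ _) (*<* (ℤ.+<+ ())) _
  size-bound L n (mkℚ -[1+ _ ] _ _) (*<* ()) _

open import Defs
open Absorption using (module Absorbers)
open Numerics using (threshold; rounds-exist)
open RationalBounds using (degree-bound; size-bound)
open import Data.Nat using (ℕ; _≥_; s≤s; z≤n) renaming (_*_ to _*ℕ_)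
open import Data.Nat.Properties using (≤-trans; *-monoʳ-≤)
open import Data.Fin using (Fin)
open import Data.List using (List; []; _∷_; length)
open import Data.List.Relation.Unary.Unique.Propositional using (Unique)
open import Data.List.Membership.Propositional using (_∈_)
open import Data.Product using (Σ; _×_; _,_)
open import Data.Integer using (+_)
open import Data.Rational using (module ℚ; ℚ; _/_; _<_; _≤_; _*_; _-_; ½; 0ℚ)

lemma3p6 : (ε : ℚ) → 0ℚ < ε → ε < ½ →
    Σ ℕ λ n₀ → ∀ (n : ℕ) → n ≥ n₀ →
      ∀ (c : Colouring n) → Symmetric c →
      (∀ (v : Fin n) (a : ℕ) → toℚ (monDeg c v a) ≤ (½ - ε) * toℚ n) →
      Σ (List (Path4 n)) λ F′ →
        VertexDisjointPCFamily c F′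
        × toℚ (length F′) ≤ ((+ 1 / 128) * (ε * ε)) * toℚ n
        × (∀ (x₁ x₂ y₁ y₂ : Fin n) → Unique (x₁ ∷ x₂ ∷ y₁ ∷ y₂ ∷ []) →
            Σ (Path4 n) λ P → P ∈ F′ × Absorbing c x₁ x₂ y₁ y₂ P)
lemma3p6 ε ε>0 _ = threshold r , λ n large c c-sym low-degree →
  let
      open Absorbers c c-sym r (λ v a → degree-bound (monDeg c v a) n ε ε>0 (low-degree v a))
      h , room , size , n⁴<2^h = rounds-exist r n large
      F , family , few-paths , absorbs = absorbing-family h (s≤s z≤n) room n⁴<2^h
  in F , family , size-bound (length F) n ε ε>0 (≤-trans (*-monoʳ-≤ (128 *ℕ (r *ℕ r)) few-paths) size) , absorbs
  where
  r = ℚ.denominatorℕ ε
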